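{- For every $\Sigma^b_1$-formula $F$, if $\vdash_{\mathcal{I}\mathcal{POR}^\lambda+\mathbf{EM}}F$, then $\vdash_{\mathcal{I}\mathcal{POR}^\lambda+\mathbf{(Markov)}}F$.
   Context: $\mathbf{EM}$ is the excluded-middle schema $G\vee\neg G$ for all formulas $G$; $\mathbf{(Markov)}$ is the schema $\neg\neg(\exists x)G\to(\exists x)G$ for $\Sigma^b_1$-formulas $G$. $\mathcal{I}\mathcal{POR}^\lambda+\mathbf{EM}$ and $\mathcal{I}\mathcal{POR}^\lambda+\mathbf{(Markov)}$ are the extensions of $\mathcal{I}\mathcal{POR}^\lambda$ by these schemas. Formulas: $\mathtt{1}^t:=\mathsf{Times}(\mathsf{1},t)$; $(\exists x\preceq t)F:=\exists x(\mathtt{1}^x\subseteq\mathtt{1}^t\wedge F)$; subword quantifiers $(\exists x\subseteq^*t)F:=\exists x\exists w(w\subseteq t\wedge wx\subseteq t\wedge F)$, $(\forall x\subseteq^*t)F:=\forall x(\exists w(w\subseteq t\wedge wx\subseteq t)\to F)$. $\Sigma^b_0$: smallest class containing atomic formulas ($t=u$, $t\subseteq u$, $\mathtt{Flip}(t)$), closed under Boolean connectives and subword quantifiers; $\Sigma^b_1$: $(\exists x_1\preceq t_1)\cdots(\exists x_n\preceq t_n)F$ with $F\in\Sigma^b_0$. $\mathcal{POR}^\lambda$: simply typed $\lambda$-calculus with base type $s$ and constants $\mathsf{0},\mathsf{1},\epsilon:s$; $\circ$ (concatenation, written $xy$); $\mathsf{Tail}$; $\mathsf{Trunc}$; $\mathsf{Cond}$;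 $\mathsf{Flipcoin}:s\Rightarrow s$; $\mathsf{Rec}:s\Rightarrow(s\Rightarrow s\Rightarrow s)\Rightarrow(s\Rightarrow s\Rightarrow s)\Rightarrow(s\Rightarrow s)\Rightarrow s\Rightarrow s$, with equational axioms ($\mathsf{b}\in\{\mathsf{0},\mathsf{1}\}$): $\epsilon x=x\epsilon=x$; $x(y\mathsf{b})=(xy)\mathsf{b}$; $\mathsf{Tail}(\epsilon)=\epsilon$, $\mathsf{Tail}(x\mathsf{b})=x$; $\mathsf{Trunc}(x,\epsilon)=\mathsf{Trunc}(\epsilon,x)=\epsilon$, $\mathsf{Trunc}(x\mathsf{b},y\mathsf{0})=\mathsf{Trunc}(x\mathsf{b},y\mathsf{1})=\mathsf{Trunc}(x,y)\mathsf{b}$; $\mathsf{Cond}(\epsilon,y,z,w)=y$, $\mathsf{Cond}(x\mathsf{0},y,z,w)=z$, $\mathsf{Cond}(x\mathsf{1},y,z,w)=w$; $\mathsf{Bool}(\mathsf{Flipcoin}(x))=\mathsf{1}$; $\mathsf{Rec}(x,h_0,h_1,k,\epsilon)=x$, $\mathsf{Rec}(x,h_0,h_1,k,y\mathsf{b})=\mathsf{Trunc}(h_b\,y\,(\mathsf{Rec}(x,h_0,h_1,k,y)),k\,y)$; $\beta$- and $\eta$-axioms in contexts. Here $\mathsf{B}(x):=\mathsf{Cond}(x,\epsilon,\mathsf{0},\mathsf{1})$, $\mathsf{BNeg}(x):=\mathsf{Cond}(x,\epsilon,\mathsf{1},\mathsf{0})$, $\mathsf{BOr}(x,y):=\mathsf{Cond}(\mathsf{B}(x),\mathsf{B}(y),\mathsf{B}(y),\mathsf{1})$,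 $\mathsf{BAnd}(x,y):=\mathsf{Cond}(\mathsf{B}(x),\epsilon,\mathsf{0},\mathsf{B}(y))$, $\mathsf{Eps}(x):=\mathsf{Cond}(x,\mathsf{1},\mathsf{0},\mathsf{0})$, $\mathsf{Bool}(x):=\mathsf{BAnd}(\mathsf{Eps}(\mathsf{Tail}(x)),\mathsf{BNeg}(\mathsf{Eps}(x)))$; $\mathsf{Conc},\mathsf{Eq},\mathsf{Times},\mathsf{Sub}$ are the $\mathsf{Rec}$-defined terms with $\mathsf{Conc}(x,\epsilon)=x$, $\mathsf{Conc}(x,y\mathsf{b})=\mathsf{Conc}(x,y)\mathsf{b}$; $\mathsf{Eq}(\epsilon,\epsilon)=\mathsf{1}$, $\mathsf{Eq}(\epsilon,y\mathsf{b})=\mathsf{Eq}(x\mathsf{b},\epsilon)=\mathsf{Eq}(x\mathsf{0},y\mathsf{1})=\mathsf{Eq}(x\mathsf{1},y\mathsf{0})=\mathsf{0}$, $\mathsf{Eq}(x\mathsf{b},y\mathsf{b})=\mathsf{Eq}(x,y)$; $\mathsf{Times}(x,\epsilon)=\epsilon$, $\mathsf{Times}(x,y\mathsf{b})=\mathsf{Conc}(\mathsf{Times}(x,y),x)$; $\mathsf{Sub}(x,\epsilon)=\mathsf{Eps}(x)$, $\mathsf{Sub}(x,y\mathsf{b})=\mathsf{BOr}(\mathsf{Sub}(x,y),\mathsf{Eq}(x,y\mathsf{b}))$. $\mathcal{I}\mathcal{POR}^\lambda$: first-order intuitionistic theory with equality over $\mathcal{POR}^\lambda$-terms, formulas built from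 $t=u$, $t\subseteq u$, $\mathtt{Flip}(t)$ with $\wedge,\vee,\to,\forall,\exists$ ($\bot:=\mathsf{0}=\mathsf{1}$, $\neg F:=F\to\bot$); axioms: those of $\mathcal{POR}^\lambda$; $x\subseteq y\leftrightarrow\mathsf{Sub}(x,y)=\mathsf{1}$; $x=\epsilon\vee x=\mathsf{Tail}(x)\mathsf{0}\vee x=\mathsf{Tail}(x)\mathsf{1}$; $\mathsf{0}=\mathsf{1}\to x=\epsilon$; $\mathsf{Cond}(x,y,z,w)=w'\leftrightarrow(x=\epsilon\wedge w'=y)\vee(x=\mathsf{Tail}(x)\mathsf{0}\wedge w'=z)\vee(x=\mathsf{Tail}(x)\mathsf{1}\wedge w'=w)$; $\mathtt{Flip}(x)\leftrightarrow\mathsf{Flipcoin}(x)=\mathsf{1}$; NP-induction $(F(\epsilon)\wedge\forall x(F(x)\to F(x\mathsf{0}))\wedge\forall x(F(x)\to F(x\mathsf{1})))\to\forall yF(y)$ for $F$ of the form $(\exists z\preceq t)u=v$ with $t$ containing only first-order open variables. -}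

module Defs where

open import Data.Nat using (ℕ)
open import Data.List using (List; []; _∷_; map; replicate)
open import Data.List.Membership.Propositional using (_∈_)
open import Data.Product using (Σ; _×_; _,_)
open import Relation.Binary.PropositionalEquality using (_≡_)

infixr 7 _⇒_

data Ty : Set where
  s   : Ty
  _⇒_ : Ty → Ty → Ty

Ctx : Set
Ctx = List Ty

variable
  Γ Δ : Ctx
  σ τ : Ty

data _∋_ : Ctx → Ty → Set where
  here  : (σ ∷ Γ) ∋ σ
  there : Γ ∋ σ → (τ ∷ Γ) ∋ σ

-- Constants of POR^λ.
-- Conc, Eq, Times, Sub (the paper's "Rec-defined terms") are included as
-- constants governed by their defining recursion equations.

data Const : Ty → Set where
  c0 c1 cε  : Const s
  c∘        : Const (s ⇒ s ⇒ s)
  cTail     : Const (s ⇒ s)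
  cTrunc    : Const (s ⇒ s ⇒ s)
  cCond     : Const (s ⇒ s ⇒ s ⇒ s ⇒ s)
  cFlipcoin : Const (s ⇒ s)
  cRec      : Const (s ⇒ (s ⇒ s ⇒ s) ⇒ (s ⇒ s ⇒ s) ⇒ (s ⇒ s) ⇒ s ⇒ s)
  cConc cEq cTimes cSub : Const (s ⇒ s ⇒ s)

data Tm (Γ : Ctx) : Ty → Set where
  var : Γ ∋ σ → Tm Γ σ
  con : Const σ → Tm Γ σ
  lam : Tm (σ ∷ Γ) τ → Tm Γ (σ ⇒ τ)
  app : Tm Γ (σ ⇒ τ) → Tm Γ σ → Tm Γ τ

Ren : Ctx → Ctx → Set
Ren Γ Δ = ∀ {σ} → Γ ∋ σ → Δ ∋ σ

ext : Ren Γ Δ → Ren (τ ∷ Γ) (τ ∷ Δ)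
ext ρ here      = here
ext ρ (there x) = there (ρ x)

ren : Ren Γ Δ → Tm Γ σ → Tm Δ σ
ren ρ (var x)   = var (ρ x)
ren ρ (con c)   = con c
ren ρ (lam t)   = lam (ren (ext ρ) t)
ren ρ (app t u) = app (ren ρ t) (ren ρ u)

wk : Tm Γ σ → Tm (τ ∷ Γ) σ
wk = ren there

Subst : Ctx → Ctx → Set
Subst Γ Δ = ∀ {σ} → Γ ∋ σ → Tm Δ σ

exts : Subst Γ Δ → Subst (τ ∷ Γ) (τ ∷ Δ)
exts θ here      = var here
exts θ (there x) = wk (θ x)

sub : Subst Γ Δ → Tm Γ σ → Tm Δ σ
sub θ (var x)   = θ x
sub θ (con c)   = con c
sub θ (lam t)   = lam (sub (exts θ) t)
sub θ (app t u) = app (sub θ t) (sub θ u)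

single : Tm Γ σ → Subst (σ ∷ Γ) Γ
single u here      = u
single u (there x) = var x

_[_]₀ : Tm (σ ∷ Γ) τ → Tm Γ σ → Tm Γ τ
t [ u ]₀ = sub (single u) t

𝟎 𝟏 ε : Tm Γ s
𝟎 = con c0
𝟏 = con c1
ε = con cε

infixl 8 _⌢_
_⌢_ : Tm Γ s → Tm Γ s → Tm Γ s
x ⌢ y = app (app (con c∘) x) y

Tail Flipcoin : Tm Γ s → Tm Γ s
Tail x     = app (con cTail) x
Flipcoin x = app (con cFlipcoin) x

Trunc Conc EqT Times SubT : Tm Γ s → Tm Γ s → Tm Γ s
Trunc x y = app (app (con cTrunc) x) y
Conc  x y = app (app (con cConc) x) y
EqT   x y = app (app (con cEq) x) y
Times x y = app (app (con cTimes) x) y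
SubT  x y = app (app (con cSub) x) y

Cond : Tm Γ s → Tm Γ s → Tm Γ s → Tm Γ s → Tm Γ s
Cond x y z w = app (app (app (app (con cCond) x) y) z) w

Rec : Tm Γ s → Tm Γ (s ⇒ s ⇒ s) → Tm Γ (s ⇒ s ⇒ s) → Tm Γ (s ⇒ s) → Tm Γ s → Tm Γ s
Rec x h₀ h₁ k y = app (app (app (app (app (con cRec) x) h₀) h₁) k) y

B BNeg Eps Bool : Tm Γ s → Tm Γ s
B x    = Cond x ε 𝟎 𝟏
BNeg x = Cond x ε 𝟏 𝟎
Eps x  = Cond x 𝟏 𝟎 𝟎

BOr BAnd : Tm Γ s → Tm Γ s → Tm Γ s
BOr x y  = Cond (B x) (B y) (B y) 𝟏
BAnd x y = Cond (B x) ε 𝟎 (B y)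

Bool x = BAnd (Eps (Tail x)) (BNeg (Eps x))

data Bit : Set where
  b0 b1 : Bit

bit : Bit → Tm Γ s
bit b0 = 𝟎
bit b1 = 𝟏

data _↝_ {Γ : Ctx} : ∀ {σ} → Tm Γ σ → Tm Γ σ → Set where
  β    : (t : Tm (σ ∷ Γ) τ) (u : Tm Γ σ) → app (lam t) u ↝ (t [ u ]₀)
  η    : (t : Tm Γ (σ ⇒ τ)) → lam (app (wk t) (var here)) ↝ t
  ξlam : {t t' : Tm (σ ∷ Γ) τ} → t ↝ t' → lam t ↝ lam t'
  ξapl : {t t' : Tm Γ (σ ⇒ τ)} {u : Tm Γ σ} → t ↝ t' → app t u ↝ app t' u
  ξapr : {t : Tm Γ (σ ⇒ τ)} {u u' : Tm Γ σ} → u ↝ u' → app t u ↝ app t u'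

infix  6 _≐_ _⊆_
infixr 5 _∧_
infixr 4 _∨_
infixr 3 _⊃_ _⇔_

data Fm (Γ : Ctx) : Set where
  _≐_ _⊆_     : Tm Γ s → Tm Γ s → Fm Γ
  Flip        : Tm Γ s → Fm Γ
  _∧_ _∨_ _⊃_ : Fm Γ → Fm Γ → Fm Γ
  ∀' ∃'       : Fm (s ∷ Γ) → Fm Γ

renF : Ren Γ Δ → Fm Γ → Fm Δ
renF ρ (t ≐ u) = ren ρ t ≐ ren ρ u
renF ρ (t ⊆ u) = ren ρ t ⊆ ren ρ u
renF ρ (Flip t) = Flip (ren ρ t)
renF ρ (A ∧ B) = renF ρ A ∧ renF ρ B
renF ρ (A ∨ B) = renF ρ A ∨ renF ρ B
renF ρ (A ⊃ B) = renF ρ A ⊃ renF ρ B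
renF ρ (∀' A) = ∀' (renF (ext ρ) A)
renF ρ (∃' A) = ∃' (renF (ext ρ) A)

wkF : Fm Γ → Fm (τ ∷ Γ)
wkF = renF there

subF : Subst Γ Δ → Fm Γ → Fm Δ
subF θ (t ≐ u) = sub θ t ≐ sub θ u
subF θ (t ⊆ u) = sub θ t ⊆ sub θ u
subF θ (Flip t) = Flip (sub θ t)
subF θ (A ∧ B) = subF θ A ∧ subF θ B
subF θ (A ∨ B) = subF θ A ∨ subF θ B
subF θ (A ⊃ B) = subF θ A ⊃ subF θ B
subF θ (∀' A) = ∀' (subF (exts θ) A)
subF θ (∃' A) = ∃' (subF (exts θ) A)

_[_]F : Fm (s ∷ Γ) → Tm Γ s → Fm Γ
A [ u ]F = subF (single u) A

_⇔_ : Fm Γ → Fm Γ → Fm Γ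
A ⇔ B = (A ⊃ B) ∧ (B ⊃ A)

⊥' : Fm Γ
⊥' = 𝟎 ≐ 𝟏

¬' : Fm Γ → Fm Γ
¬' A = A ⊃ ⊥'

1^ : Tm Γ s → Tm Γ s
1^ t = Times 𝟏 t

∃⪯ : Tm Γ s → Fm (s ∷ Γ) → Fm Γ
∃⪯ t F = ∃' (1^ (var here) ⊆ 1^ (wk t) ∧ F)

-- (∃x ⊆* t) F := ∃x ∃w (w ⊆ t ∧ wx ⊆ t ∧ F)      (w innermost)
∃⊆* : Tm Γ s → Fm (s ∷ Γ) → Fm Γ
∃⊆* t F = ∃' (∃' (var here ⊆ wk (wk t) ∧ (var here ⌢ var (there here)) ⊆ wk (wk t) ∧ wkF F))

-- (∀x ⊆* t) F := ∀x (∃w (w ⊆ t ∧ wx ⊆ t) → F)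
∀⊆* : Tm Γ s → Fm (s ∷ Γ) → Fm Γ
∀⊆* t F = ∀' (∃' (var here ⊆ wk (wk t) ∧ (var here ⌢ var (there here)) ⊆ wk (wk t)) ⊃ F)

data Σb0 : ∀ {Γ} → Fm Γ → Set where
  eq   : (t u : Tm Γ s) → Σb0 (t ≐ u)
  sb   : (t u : Tm Γ s) → Σb0 (t ⊆ u)
  flip : (t : Tm Γ s) → Σb0 (Flip t)
  and  : {A B : Fm Γ} → Σb0 A → Σb0 B → Σb0 (A ∧ B)
  or   : {A B : Fm Γ} → Σb0 A → Σb0 B → Σb0 (A ∨ B)
  imp  : {A B : Fm Γ} → Σb0 A → Σb0 B → Σb0 (A ⊃ B)
  bex  : (t : Tm Γ s) {F : Fm (s ∷ Γ)} → Σb0 F → Σb0 (∃⊆* t F)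
  ball : (t : Tm Γ s) {F : Fm (s ∷ Γ)} → Σb0 F → Σb0 (∀⊆* t F)

data Σb1 : ∀ {Γ} → Fm Γ → Set where
  base : {F : Fm Γ} → Σb0 F → Σb1 F
  bex⪯ : (t : Tm Γ s) {F : Fm (s ∷ Γ)} → Σb1 F → Σb1 (∃⪯ t F)

-- Terms whose free (open) variables are all first-order

FOTm : Tm Γ σ → Set
FOTm {Γ} {σ} t =
  Σ ℕ λ n → Σ (Ren (replicate n s) Γ) λ ρ → Σ (Tm (replicate n s) σ) λ t' → ren ρ t' ≡ t

hsel : Bit → Tm Γ (s ⇒ s ⇒ s) → Tm Γ (s ⇒ s ⇒ s) → Tm Γ (s ⇒ s ⇒ s)
hsel b0 h₀ h₁ = h₀
hsel b1 h₀ h₁ = h₁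

stepSub : Bit → Subst (s ∷ Γ) (s ∷ Γ)
stepSub b here      = var here ⌢ bit b
stepSub b (there x) = var (there x)

data Ax {Γ : Ctx} : Fm Γ → Set where
  ε⌢     : (x : Tm Γ s) → Ax (ε ⌢ x ≐ x)
  ⌢ε     : (x : Tm Γ s) → Ax (x ⌢ ε ≐ x)
  ⌢assoc : (x y : Tm Γ s) (b : Bit) → Ax (x ⌢ (y ⌢ bit b) ≐ (x ⌢ y) ⌢ bit b)
  tailε  : Ax (Tail ε ≐ ε)
  tailb  : (x : Tm Γ s) (b : Bit) → Ax (Tail (x ⌢ bit b) ≐ x)
  truncε₂ : (x : Tm Γ s) → Ax (Trunc x ε ≐ ε)
  truncε₁ : (x : Tm Γ s) → Ax (Trunc ε x ≐ ε)
  truncb : (x y : Tm Γ s) (b b' : Bit) →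
           Ax (Trunc (x ⌢ bit b) (y ⌢ bit b') ≐ Trunc x y ⌢ bit b)
  condε  : (y z w : Tm Γ s) → Ax (Cond ε y z w ≐ y)
  cond0  : (x y z w : Tm Γ s) → Ax (Cond (x ⌢ 𝟎) y z w ≐ z)
  cond1  : (x y z w : Tm Γ s) → Ax (Cond (x ⌢ 𝟏) y z w ≐ w)
  flipc  : (x : Tm Γ s) → Ax (Bool (Flipcoin x) ≐ 𝟏)
  recε   : (x : Tm Γ s) (h₀ h₁ : Tm Γ (s ⇒ s ⇒ s)) (k : Tm Γ (s ⇒ s)) →
           Ax (Rec x h₀ h₁ k ε ≐ x)
  recb   : (x : Tm Γ s) (h₀ h₁ : Tm Γ (s ⇒ s ⇒ s)) (k : Tm Γ (s ⇒ s)) (y : Tm Γ s) (b : Bit) →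
           Ax (Rec x h₀ h₁ k (y ⌢ bit b)
               ≐ Trunc (app (app (hsel b h₀ h₁) y) (Rec x h₀ h₁ k y)) (app k y))
  βη     : {t u : Tm Γ s} → t ↝ u → Ax (t ≐ u)
  concε  : (x : Tm Γ s) → Ax (Conc x ε ≐ x)
  concb  : (x y : Tm Γ s) (b : Bit) → Ax (Conc x (y ⌢ bit b) ≐ Conc x y ⌢ bit b)
  eqεε   : Ax (EqT ε ε ≐ 𝟏)
  eqεb   : (y : Tm Γ s) (b : Bit) → Ax (EqT ε (y ⌢ bit b) ≐ 𝟎)
  eqbε   : (x : Tm Γ s) (b : Bit) → Ax (EqT (x ⌢ bit b) ε ≐ 𝟎)
  eq01   : (x y : Tm Γ s) → Ax (EqT (x ⌢ 𝟎) (y ⌢ 𝟏) ≐ 𝟎)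
  eq10   : (x y : Tm Γ s) → Ax (EqT (x ⌢ 𝟏) (y ⌢ 𝟎) ≐ 𝟎)
  eqbb   : (x y : Tm Γ s) (b : Bit) → Ax (EqT (x ⌢ bit b) (y ⌢ bit b) ≐ EqT x y)
  timesε : (x : Tm Γ s) → Ax (Times x ε ≐ ε)
  timesb : (x y : Tm Γ s) (b : Bit) → Ax (Times x (y ⌢ bit b) ≐ Conc (Times x y) x)
  subε   : (x : Tm Γ s) → Ax (SubT x ε ≐ Eps x)
  subb   : (x y : Tm Γ s) (b : Bit) →
           Ax (SubT x (y ⌢ bit b) ≐ BOr (SubT x y) (EqT x (y ⌢ bit b)))
  subAx  : (x y : Tm Γ s) → Ax (x ⊆ y ⇔ SubT x y ≐ 𝟏)
  cases  : (x : Tm Γ s) → Ax (x ≐ ε ∨ x ≐ Tail x ⌢ 𝟎 ∨ x ≐ Tail x ⌢ 𝟏)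
  triv   : (x : Tm Γ s) → Ax (𝟎 ≐ 𝟏 ⊃ x ≐ ε)
  condAx : (x y z w w' : Tm Γ s) →
           Ax (Cond x y z w ≐ w' ⇔
               (x ≐ ε ∧ w' ≐ y) ∨ (x ≐ Tail x ⌢ 𝟎 ∧ w' ≐ z) ∨ (x ≐ Tail x ⌢ 𝟏 ∧ w' ≐ w))
  flipAx : (x : Tm Γ s) → Ax (Flip x ⇔ Flipcoin x ≐ 𝟏)
  -- NP-induction for F(y) = (∃z ⪯ t) u = v, t with only first-order open variables
  npInd  : (t : Tm (s ∷ Γ) s) → FOTm t → (u v : Tm (s ∷ s ∷ Γ) s) →
           let F = ∃⪯ t (u ≐ v) in
           Ax ((F [ ε ]F ∧ ∀' (F ⊃ subF (stepSub b0) F) ∧ ∀' (F ⊃ subF (stepSub b1) F))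
               ⊃ ∀' F)

Schema : Set₁
Schema = ∀ {Γ} → Fm Γ → Set

data Der (E : Schema) : (Γ : Ctx) → List (Fm Γ) → Fm Γ → Set where
  hyp   : {Hs : List (Fm Γ)} {A : Fm Γ} → A ∈ Hs → Der E Γ Hs A
  ax    : {Hs : List (Fm Γ)} {A : Fm Γ} → Ax A → Der E Γ Hs A
  extra : {Hs : List (Fm Γ)} {A : Fm Γ} → E A → Der E Γ Hs A
  refl≐ : {Hs : List (Fm Γ)} (t : Tm Γ s) → Der E Γ Hs (t ≐ t)
  leib  : {Hs : List (Fm Γ)} (A : Fm (s ∷ Γ)) {t u : Tm Γ s} →
          Der E Γ Hs (t ≐ u) → Der E Γ Hs (A [ t ]F) → Der E Γ Hs (A [ u ]F)
  ∧I    : {Hs : List (Fm Γ)} {A B : Fm Γ} → Der E Γ Hs A → Der E Γ Hs B → Der E Γ Hs (A ∧ B)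
  ∧E₁   : {Hs : List (Fm Γ)} {A B : Fm Γ} → Der E Γ Hs (A ∧ B) → Der E Γ Hs A
  ∧E₂   : {Hs : List (Fm Γ)} {A B : Fm Γ} → Der E Γ Hs (A ∧ B) → Der E Γ Hs B
  ∨I₁   : {Hs : List (Fm Γ)} {A B : Fm Γ} → Der E Γ Hs A → Der E Γ Hs (A ∨ B)
  ∨I₂   : {Hs : List (Fm Γ)} {A B : Fm Γ} → Der E Γ Hs B → Der E Γ Hs (A ∨ B)
  ∨E    : {Hs : List (Fm Γ)} {A B C : Fm Γ} → Der E Γ Hs (A ∨ B) →
          Der E Γ (A ∷ Hs) C → Der E Γ (B ∷ Hs) C → Der E Γ Hs C
  ⊃I    : {Hs : List (Fm Γ)} {A B : Fm Γ} → Der E Γ (A ∷ Hs) B → Der E Γ Hs (A ⊃ B)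
  ⊃E    : {Hs : List (Fm Γ)} {A B : Fm Γ} → Der E Γ Hs (A ⊃ B) → Der E Γ Hs A → Der E Γ Hs B
  ∀I    : {Hs : List (Fm Γ)} {A : Fm (s ∷ Γ)} → Der E (s ∷ Γ) (map wkF Hs) A → Der E Γ Hs (∀' A)
  ∀E    : {Hs : List (Fm Γ)} {A : Fm (s ∷ Γ)} → Der E Γ Hs (∀' A) → (t : Tm Γ s) →
          Der E Γ Hs (A [ t ]F)
  ∃I    : {Hs : List (Fm Γ)} {A : Fm (s ∷ Γ)} (t : Tm Γ s) → Der E Γ Hs (A [ t ]F) →
          Der E Γ Hs (∃' A)
  ∃E    : {Hs : List (Fm Γ)} {A : Fm (s ∷ Γ)} {C : Fm Γ} → Der E Γ Hs (∃' A) →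
          Der E (s ∷ Γ) (A ∷ map wkF Hs) (wkF C) → Der E Γ Hs C

data EM : Schema where
  em : {Γ : Ctx} (G : Fm Γ) → EM (G ∨ ¬' G)

data Markov : Schema where
  markov : {Γ : Ctx} (G : Fm (s ∷ Γ)) → Σb1 G → Markov (¬' (¬' (∃' G)) ⊃ ∃' G)

-- ⊢_{IPOR^λ + E} A   (no open assumptions; free variables from Γ allowed)
⊢[_]_ : Schema → Fm Γ → Set
⊢[_]_ {Γ} E A = Der E Γ [] A

-- Gödel–Gentzen negative translation.  A derivation with excluded middle becomes a
-- derivation of the translated formula from the translated hypotheses, since the
-- translation of G ∨ ¬G is intuitionistically provable and translated formulas are
-- ¬¬-stable.  Markov's principle, applied to a vacuous quantifier, makes every Σb0
-- formula stable, hence equivalent to its translation; pushing ¬¬ through the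
-- bounded existential prefix, again by Markov's principle, gives the same for Σb1
-- formulas and for the NP-induction axioms.  So a Σb1 formula follows from its
-- translation.
module Submission where

open import Defs
open import Data.List using (List; []; _∷_; map)
open import Data.List.Membership.Propositional.Properties using (∈-map⁺)
open import Data.List.Relation.Binary.Subset.Propositional using () renaming (_⊆_ to _⊑_)
open import Data.List.Relation.Binary.Subset.Propositional.Properties using (map⁺; xs⊆x∷xs; ∷⁺ʳ)
open import Data.List.Relation.Unary.Any using (here; there)
open import Data.Product using (Σ; _×_; _,_)
open import Relation.Binary.PropositionalEquality
  using (_≡_; refl; sym; trans; cong; cong₂; subst; subst₂)

variable
  Θ : Ctx
  P P' Q Q' R F : Fm Γ
  Hs Hs' : List (Fm Γ)

ext-∘ : {ρ : Ren Δ Θ} {ρ' : Ren Γ Δ} {ρ'' : Ren Γ Θ} →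
        (∀ {σ} (x : Γ ∋ σ) → ρ (ρ' x) ≡ ρ'' x) →
        ∀ {σ} (x : (τ ∷ Γ) ∋ σ) → ext ρ (ext ρ' x) ≡ ext ρ'' x
ext-∘ h here      = refl
ext-∘ h (there x) = cong there (h x)

ren-∘ : (ρ : Ren Δ Θ) (ρ' : Ren Γ Δ) {ρ'' : Ren Γ Θ} →
        (∀ {σ} (x : Γ ∋ σ) → ρ (ρ' x) ≡ ρ'' x) →
        (t : Tm Γ σ) → ren ρ (ren ρ' t) ≡ ren ρ'' t
ren-∘ ρ ρ' h (var x)   = cong var (h x)
ren-∘ ρ ρ' h (con c)   = refl
ren-∘ ρ ρ' h (lam t)   = cong lam (ren-∘ (ext ρ) (ext ρ') (ext-∘ h) t)
ren-∘ ρ ρ' h (app t u) = cong₂ app (ren-∘ ρ ρ' h t) (ren-∘ ρ ρ' h u)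

renF-∘ : (ρ : Ren Δ Θ) (ρ' : Ren Γ Δ) {ρ'' : Ren Γ Θ} →
         (∀ {σ} (x : Γ ∋ σ) → ρ (ρ' x) ≡ ρ'' x) →
         (P : Fm Γ) → renF ρ (renF ρ' P) ≡ renF ρ'' P
renF-∘ ρ ρ' h (t ≐ u)  = cong₂ _≐_ (ren-∘ ρ ρ' h t) (ren-∘ ρ ρ' h u)
renF-∘ ρ ρ' h (t ⊆ u)  = cong₂ _⊆_ (ren-∘ ρ ρ' h t) (ren-∘ ρ ρ' h u)
renF-∘ ρ ρ' h (Flip t) = cong Flip (ren-∘ ρ ρ' h t)
renF-∘ ρ ρ' h (P ∧ Q)  = cong₂ _∧_ (renF-∘ ρ ρ' h P) (renF-∘ ρ ρ' h Q)
renF-∘ ρ ρ' h (P ∨ Q)  = cong₂ _∨_ (renF-∘ ρ ρ' h P) (renF-∘ ρ ρ' h Q)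
renF-∘ ρ ρ' h (P ⊃ Q)  = cong₂ _⊃_ (renF-∘ ρ ρ' h P) (renF-∘ ρ ρ' h Q)
renF-∘ ρ ρ' h (∀' P)   = cong ∀' (renF-∘ (ext ρ) (ext ρ') (ext-∘ h) P)
renF-∘ ρ ρ' h (∃' P)   = cong ∃' (renF-∘ (ext ρ) (ext ρ') (ext-∘ h) P)

ext-id : {ρ : Ren Γ Γ} → (∀ {σ} (x : Γ ∋ σ) → ρ x ≡ x) →
         ∀ {σ} (x : (τ ∷ Γ) ∋ σ) → ext ρ x ≡ x
ext-id h here      = refl
ext-id h (there x) = cong there (h x)

ren-id : {ρ : Ren Γ Γ} → (∀ {σ} (x : Γ ∋ σ) → ρ x ≡ x) → (t : Tm Γ σ) → ren ρ t ≡ t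
ren-id h (var x)   = cong var (h x)
ren-id h (con c)   = refl
ren-id h (lam t)   = cong lam (ren-id (ext-id h) t)
ren-id h (app t u) = cong₂ app (ren-id h t) (ren-id h u)

renF-id : {ρ : Ren Γ Γ} → (∀ {σ} (x : Γ ∋ σ) → ρ x ≡ x) → (P : Fm Γ) → renF ρ P ≡ P
renF-id h (t ≐ u)  = cong₂ _≐_ (ren-id h t) (ren-id h u)
renF-id h (t ⊆ u)  = cong₂ _⊆_ (ren-id h t) (ren-id h u)
renF-id h (Flip t) = cong Flip (ren-id h t)
renF-id h (P ∧ Q)  = cong₂ _∧_ (renF-id h P) (renF-id h Q)
renF-id h (P ∨ Q)  = cong₂ _∨_ (renF-id h P) (renF-id h Q)
renF-id h (P ⊃ Q)  = cong₂ _⊃_ (renF-id h P) (renF-id h Q)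
renF-id h (∀' P)   = cong ∀' (renF-id (ext-id h) P)
renF-id h (∃' P)   = cong ∃' (renF-id (ext-id h) P)

exts-ext : {θ : Subst Δ Γ} {ρ : Ren Γ Δ} → (∀ {σ} (x : Γ ∋ σ) → θ (ρ x) ≡ var x) →
           ∀ {σ} (x : (τ ∷ Γ) ∋ σ) → exts θ (ext ρ x) ≡ var x
exts-ext h here      = refl
exts-ext h (there x) = cong wk (h x)

sub-ren : {θ : Subst Δ Γ} {ρ : Ren Γ Δ} → (∀ {σ} (x : Γ ∋ σ) → θ (ρ x) ≡ var x) →
          (t : Tm Γ σ) → sub θ (ren ρ t) ≡ t
sub-ren h (var x)   = h x
sub-ren h (con c)   = refl
sub-ren h (lam t)   = cong lam (sub-ren (exts-ext h) t)
sub-ren h (app t u) = cong₂ app (sub-ren h t) (sub-ren h u)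

subF-renF : {θ : Subst Δ Γ} {ρ : Ren Γ Δ} → (∀ {σ} (x : Γ ∋ σ) → θ (ρ x) ≡ var x) →
            (P : Fm Γ) → subF θ (renF ρ P) ≡ P
subF-renF h (t ≐ u)  = cong₂ _≐_ (sub-ren h t) (sub-ren h u)
subF-renF h (t ⊆ u)  = cong₂ _⊆_ (sub-ren h t) (sub-ren h u)
subF-renF h (Flip t) = cong Flip (sub-ren h t)
subF-renF h (P ∧ Q)  = cong₂ _∧_ (subF-renF h P) (subF-renF h Q)
subF-renF h (P ∨ Q)  = cong₂ _∨_ (subF-renF h P) (subF-renF h Q)
subF-renF h (P ⊃ Q)  = cong₂ _⊃_ (subF-renF h P) (subF-renF h Q)
subF-renF h (∀' P)   = cong ∀' (subF-renF (exts-ext h) P)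
subF-renF h (∃' P)   = cong ∃' (subF-renF (exts-ext h) P)

wk-ren : (ρ : Ren Γ Δ) (t : Tm Γ σ) → wk {τ = τ} (ren ρ t) ≡ ren (ext ρ) (wk t)
wk-ren ρ t = trans (ren-∘ there ρ (λ _ → refl) t) (sym (ren-∘ (ext ρ) there (λ _ → refl) t))

wkF-renF : (ρ : Ren Γ Δ) (P : Fm Γ) → wkF {τ = τ} (renF ρ P) ≡ renF (ext ρ) (wkF P)
wkF-renF ρ P = trans (renF-∘ there ρ (λ _ → refl) P) (sym (renF-∘ (ext ρ) there (λ _ → refl) P))

wkF-[]F : (P : Fm Γ) (u : Tm Γ s) → wkF P [ u ]F ≡ P
wkF-[]F P u = subF-renF (λ _ → refl) P

ext-there-[]F : (P : Fm (s ∷ Γ)) → renF (ext there) P [ var here ]F ≡ P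
ext-there-[]F = subF-renF single-ext-there
  where
  single-ext-there : ∀ {σ} (x : (s ∷ Γ) ∋ σ) → single (var here) (ext there x) ≡ var x
  single-ext-there here      = refl
  single-ext-there (there x) = refl

wk²-ren : (ρ : Ren Γ Δ) (t : Tm Γ σ) →
          wk {τ = s} (wk {τ = s} (ren ρ t)) ≡ ren (ext (ext ρ)) (wk (wk t))
wk²-ren ρ t = trans (cong wk (wk-ren ρ t)) (wk-ren (ext ρ) (wk t))

Σb0-ren : (ρ : Ren Γ Δ) → Σb0 P → Σb0 (renF ρ P)
Σb0-ren ρ (eq _ _)   = eq _ _
Σb0-ren ρ (sb _ _)   = sb _ _
Σb0-ren ρ (flip _)   = flip _
Σb0-ren ρ (and a b)  = and (Σb0-ren ρ a) (Σb0-ren ρ b)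
Σb0-ren ρ (or a b)   = or (Σb0-ren ρ a) (Σb0-ren ρ b)
Σb0-ren ρ (imp a b)  = imp (Σb0-ren ρ a) (Σb0-ren ρ b)
Σb0-ren ρ (bex t {F} a)
  rewrite sym (wk²-ren ρ t) | sym (wkF-renF {τ = s} (ext ρ) F) = bex (ren ρ t) (Σb0-ren (ext ρ) a)
Σb0-ren ρ (ball t a)
  rewrite sym (wk²-ren ρ t) = ball (ren ρ t) (Σb0-ren (ext ρ) a)

¬¬' : Fm Γ → Fm Γ
¬¬' P = ¬' (¬' P)

infix 9 _ᴺ
_ᴺ : Fm Γ → Fm Γ
(t ≐ u) ᴺ  = ¬¬' (t ≐ u)
(t ⊆ u) ᴺ  = ¬¬' (t ⊆ u)
Flip t ᴺ   = ¬¬' (Flip t)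
(P ∧ Q) ᴺ  = P ᴺ ∧ Q ᴺ
(P ∨ Q) ᴺ  = ¬¬' (P ᴺ ∨ Q ᴺ)
(P ⊃ Q) ᴺ  = P ᴺ ⊃ Q ᴺ
∀' P ᴺ     = ∀' (P ᴺ)
∃' P ᴺ     = ¬¬' (∃' (P ᴺ))

ᴺ-renF : (ρ : Ren Γ Δ) (P : Fm Γ) → renF ρ P ᴺ ≡ renF ρ (P ᴺ)
ᴺ-renF ρ (t ≐ u)  = refl
ᴺ-renF ρ (t ⊆ u)  = refl
ᴺ-renF ρ (Flip t) = refl
ᴺ-renF ρ (P ∧ Q)  = cong₂ _∧_ (ᴺ-renF ρ P) (ᴺ-renF ρ Q)
ᴺ-renF ρ (P ∨ Q)  = cong ¬¬' (cong₂ _∨_ (ᴺ-renF ρ P) (ᴺ-renF ρ Q))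
ᴺ-renF ρ (P ⊃ Q)  = cong₂ _⊃_ (ᴺ-renF ρ P) (ᴺ-renF ρ Q)
ᴺ-renF ρ (∀' P)   = cong ∀' (ᴺ-renF (ext ρ) P)
ᴺ-renF ρ (∃' P)   = cong (λ Q → ¬¬' (∃' Q)) (ᴺ-renF (ext ρ) P)

ᴺ-subF : (θ : Subst Γ Δ) (P : Fm Γ) → subF θ P ᴺ ≡ subF θ (P ᴺ)
ᴺ-subF θ (t ≐ u)  = refl
ᴺ-subF θ (t ⊆ u)  = refl
ᴺ-subF θ (Flip t) = refl
ᴺ-subF θ (P ∧ Q)  = cong₂ _∧_ (ᴺ-subF θ P) (ᴺ-subF θ Q)
ᴺ-subF θ (P ∨ Q)  = cong ¬¬' (cong₂ _∨_ (ᴺ-subF θ P) (ᴺ-subF θ Q))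
ᴺ-subF θ (P ⊃ Q)  = cong₂ _⊃_ (ᴺ-subF θ P) (ᴺ-subF θ Q)
ᴺ-subF θ (∀' P)   = cong ∀' (ᴺ-subF (exts θ) P)
ᴺ-subF θ (∃' P)   = cong (λ Q → ¬¬' (∃' Q)) (ᴺ-subF (exts θ) P)

ᴺ-[]F : (P : Fm (s ∷ Γ)) (u : Tm Γ s) → P [ u ]F ᴺ ≡ (P ᴺ) [ u ]F
ᴺ-[]F P u = ᴺ-subF (single u) P

map-ᴺ-wkF : (Hs : List (Fm Γ)) → map _ᴺ (map (wkF {τ = s}) Hs) ≡ map wkF (map _ᴺ Hs)
map-ᴺ-wkF []       = refl
map-ᴺ-wkF (P ∷ Hs) = cong₂ _∷_ (ᴺ-renF there P) (map-ᴺ-wkF Hs)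

module Derivable (E : Schema) where

  infix 2 _⊢_
  _⊢_ : List (Fm Γ) → Fm Γ → Set
  Hs ⊢ P = Der E _ Hs P

  infixl 5 _·_
  _·_ : Hs ⊢ P ⊃ Q → Hs ⊢ P → Hs ⊢ Q
  _·_ = ⊃E

  weaken : Hs ⊑ Hs' → Hs ⊢ P → Hs' ⊢ P
  weaken f (hyp m)      = hyp (f m)
  weaken f (ax a)       = ax a
  weaken f (extra e)    = extra e
  weaken f (refl≐ t)    = refl≐ t
  weaken f (leib P d e) = leib P (weaken f d) (weaken f e)
  weaken f (∧I d e)     = ∧I (weaken f d) (weaken f e)
  weaken f (∧E₁ d)      = ∧E₁ (weaken f d)
  weaken f (∧E₂ d)      = ∧E₂ (weaken f d)
  weaken f (∨I₁ d)      = ∨I₁ (weaken f d)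
  weaken f (∨I₂ d)      = ∨I₂ (weaken f d)
  weaken f (∨E d e e')  = ∨E (weaken f d) (weaken (∷⁺ʳ _ f) e) (weaken (∷⁺ʳ _ f) e')
  weaken f (⊃I d)       = ⊃I (weaken (∷⁺ʳ _ f) d)
  weaken f (⊃E d e)     = ⊃E (weaken f d) (weaken f e)
  weaken f (∀I d)       = ∀I (weaken (map⁺ wkF f) d)
  weaken f (∀E d t)     = ∀E (weaken f d) t
  weaken f (∃I t d)     = ∃I t (weaken f d)
  weaken f (∃E d e)     = ∃E (weaken f d) (weaken (∷⁺ʳ _ (map⁺ wkF f)) e)

  weaken₁ : Hs ⊢ P → Q ∷ Hs ⊢ P
  weaken₁ = weaken (xs⊆x∷xs _ _)

  weaken₂ : Hs ⊢ P → Q' ∷ Q ∷ Hs ⊢ P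
  weaken₂ d = weaken₁ (weaken₁ d)

  weaken-under : P ∷ Hs ⊢ R → P ∷ Q ∷ Hs ⊢ R
  weaken-under = weaken (∷⁺ʳ _ (xs⊆x∷xs _ _))

  hyp₀ : P ∷ Hs ⊢ P
  hyp₀ = hyp (here refl)

  hyp₁ : Q ∷ P ∷ Hs ⊢ P
  hyp₁ = hyp (there (here refl))

  ∀E-here : Hs ⊢ wkF (∀' P) → Hs ⊢ P
  ∀E-here {P = P} d = subst (_ ⊢_) (ext-there-[]F P) (∀E d (var here))

  ∃I-here : Hs ⊢ P → Hs ⊢ wkF (∃' P)
  ∃I-here {P = P} d = ∃I (var here) (subst (_ ⊢_) (sym (ext-there-[]F P)) d)

  ∨-case : P ∷ Hs ⊢ R → Q ∷ Hs ⊢ R → Hs ⊢ P ∨ Q ⊃ R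
  ∨-case d e = ⊃I (∨E hyp₀ (weaken-under d) (weaken-under e))

  ∃-case : P ∷ map wkF Hs ⊢ wkF R → Hs ⊢ ∃' P ⊃ R
  ∃-case d = ⊃I (∃E hyp₀ (weaken-under d))

  ⊃-refl : Hs ⊢ P ⊃ P
  ⊃-refl = ⊃I hyp₀

  ⊃-trans : Hs ⊢ P ⊃ Q → Hs ⊢ Q ⊃ R → Hs ⊢ P ⊃ R
  ⊃-trans f g = ⊃I (weaken₁ g · (weaken₁ f · hyp₀))

  ∧-map : Hs ⊢ P ⊃ P' → Hs ⊢ Q ⊃ Q' → Hs ⊢ P ∧ Q ⊃ P' ∧ Q'
  ∧-map f g = ⊃I (∧I (weaken₁ f · ∧E₁ hyp₀) (weaken₁ g · ∧E₂ hyp₀))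

  ∨-map : Hs ⊢ P ⊃ P' → Hs ⊢ Q ⊃ Q' → Hs ⊢ P ∨ Q ⊃ P' ∨ Q'
  ∨-map f g = ∨-case (∨I₁ (weaken₁ f · hyp₀)) (∨I₂ (weaken₁ g · hyp₀))

  ⊃-map : Hs ⊢ P' ⊃ P → Hs ⊢ Q ⊃ Q' → Hs ⊢ (P ⊃ Q) ⊃ (P' ⊃ Q')
  ⊃-map f g = ⊃I (⊃I (weaken₂ g · (hyp₁ · (weaken₂ f · hyp₀))))

  ∀-map : map wkF Hs ⊢ P ⊃ Q → Hs ⊢ ∀' P ⊃ ∀' Q
  ∀-map f = ⊃I (∀I (weaken₁ f · ∀E-here hyp₀))

  ∃-map : map wkF Hs ⊢ P ⊃ Q → Hs ⊢ ∃' P ⊃ ∃' Q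
  ∃-map f = ∃-case (∃I-here (weaken₁ f · hyp₀))

  ¬¬-map : Hs ⊢ P ⊃ Q → Hs ⊢ ¬¬' P ⊃ ¬¬' Q
  ¬¬-map f = ⊃-map (⊃-map f ⊃-refl) ⊃-refl

  ¬¬-unit : Hs ⊢ P ⊃ ¬¬' P
  ¬¬-unit = ⊃I (⊃I (hyp₀ · hyp₁))

  ¬¬-intro : Hs ⊢ P → Hs ⊢ ¬¬' P
  ¬¬-intro d = ¬¬-unit · d

  ¬¬-join : Hs ⊢ ¬¬' (¬¬' P) ⊃ ¬¬' P
  ¬¬-join = ⊃I (⊃I (hyp₁ · (¬¬-unit · hyp₀)))

  ¬¬-em : Hs ⊢ ¬¬' (P ∨ ¬' P)
  ¬¬-em = ⊃I (hyp₀ · ∨I₂ (⊃I (hyp₁ · ∨I₁ hyp₀)))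

  ∃¬¬⊃¬¬∃ : Hs ⊢ ∃' (¬¬' P) ⊃ ¬¬' (∃' P)
  ∃¬¬⊃¬¬∃ = ∃-case (¬¬-map (⊃I (∃I-here hyp₀)) · hyp₀)

  ⇔-refl : Hs ⊢ P ⇔ P
  ⇔-refl = ∧I ⊃-refl ⊃-refl

  ⇔-sym : Hs ⊢ P ⇔ Q → Hs ⊢ Q ⇔ P
  ⇔-sym e = ∧I (∧E₂ e) (∧E₁ e)

  ⇔-trans : Hs ⊢ P ⇔ Q → Hs ⊢ Q ⇔ R → Hs ⊢ P ⇔ R
  ⇔-trans e e' = ∧I (⊃-trans (∧E₁ e) (∧E₁ e')) (⊃-trans (∧E₂ e') (∧E₂ e))

  ⇔-∧ : Hs ⊢ P ⇔ P' → Hs ⊢ Q ⇔ Q' → Hs ⊢ P ∧ Q ⇔ P' ∧ Q'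
  ⇔-∧ e e' = ∧I (∧-map (∧E₁ e) (∧E₁ e')) (∧-map (∧E₂ e) (∧E₂ e'))

  ⇔-∨ : Hs ⊢ P ⇔ P' → Hs ⊢ Q ⇔ Q' → Hs ⊢ P ∨ Q ⇔ P' ∨ Q'
  ⇔-∨ e e' = ∧I (∨-map (∧E₁ e) (∧E₁ e')) (∨-map (∧E₂ e) (∧E₂ e'))

  ⇔-⊃ : Hs ⊢ P ⇔ P' → Hs ⊢ Q ⇔ Q' → Hs ⊢ (P ⊃ Q) ⇔ (P' ⊃ Q')
  ⇔-⊃ e e' = ∧I (⊃-map (∧E₂ e) (∧E₁ e')) (⊃-map (∧E₁ e) (∧E₂ e'))

  ⇔-∀ : map wkF Hs ⊢ P ⇔ Q → Hs ⊢ ∀' P ⇔ ∀' Q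
  ⇔-∀ e = ∧I (∀-map (∧E₁ e)) (∀-map (∧E₂ e))

  ⇔-∃ : map wkF Hs ⊢ P ⇔ Q → Hs ⊢ ∃' P ⇔ ∃' Q
  ⇔-∃ e = ∧I (∃-map (∧E₁ e)) (∃-map (∧E₂ e))

  ⇔-¬¬ : Hs ⊢ P ⇔ Q → Hs ⊢ ¬¬' P ⇔ ¬¬' Q
  ⇔-¬¬ e = ∧I (¬¬-map (∧E₁ e)) (¬¬-map (∧E₂ e))

  ¬¬∃¬¬⇔¬¬∃ : Hs ⊢ ¬¬' (∃' (¬¬' P)) ⇔ ¬¬' (∃' P)
  ¬¬∃¬¬⇔¬¬∃ = ∧I (⊃-trans (¬¬-map ∃¬¬⊃¬¬∃) ¬¬-join) (¬¬-map (∃-map ¬¬-unit))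

  ∃-vacuous : Hs ⊢ ∃' (wkF P) ⇔ P
  ∃-vacuous {P = P} = ∧I (∃-case hyp₀) (⊃I (∃I ε (subst (_ ⊢_) (sym (wkF-[]F P ε)) hyp₀)))

  ∧-∃ : Hs ⊢ P ∧ ∃' Q ⇔ ∃' (wkF P ∧ Q)
  ∧-∃ = ∧I (⊃I (∃E (∧E₂ hyp₀) (∃I-here (∧I (∧E₁ hyp₁) hyp₀))))
           (∃-case (∧I (∧E₁ hyp₀) (∃I-here (∧E₂ hyp₀))))

  ∧-left-comm : Hs ⊢ P ∧ Q ∧ R ⇔ Q ∧ P ∧ R
  ∧-left-comm = ∧I (⊃I (∧I (∧E₁ (∧E₂ hyp₀)) (∧I (∧E₁ hyp₀) (∧E₂ (∧E₂ hyp₀)))))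
                   (⊃I (∧I (∧E₁ (∧E₂ hyp₀)) (∧I (∧E₁ hyp₀) (∧E₂ (∧E₂ hyp₀)))))

  ᴺ-stable : (P : Fm Γ) → Hs ⊢ ¬¬' (P ᴺ) ⊃ P ᴺ
  ᴺ-stable (t ≐ u)  = ¬¬-join
  ᴺ-stable (t ⊆ u)  = ¬¬-join
  ᴺ-stable (Flip t) = ¬¬-join
  ᴺ-stable (P ∧ Q)  = ⊃I (∧I (ᴺ-stable P · (¬¬-map (⊃I (∧E₁ hyp₀)) · hyp₀))
                             (ᴺ-stable Q · (¬¬-map (⊃I (∧E₂ hyp₀)) · hyp₀)))
  ᴺ-stable (P ∨ Q)  = ¬¬-join
  ᴺ-stable (P ⊃ Q)  = ⊃I (⊃I (ᴺ-stable Q · (¬¬-map (⊃I (hyp₀ · hyp₁)) · hyp₁)))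
  ᴺ-stable (∀' P)   = ⊃I (∀I (ᴺ-stable P · (¬¬-map (⊃I (∀E-here hyp₀)) · hyp₀)))
  ᴺ-stable (∃' P)   = ¬¬-join

open Derivable Markov

¬¬⇔-∃Σb1 : Σb1 P → Hs ⊢ ¬¬' (∃' P) ⇔ ∃' P
¬¬⇔-∃Σb1 {P = P} sP = ∧I (extra (markov P sP)) ¬¬-unit

-- Markov's principle for the vacuous quantifier ∃x. P.
¬¬⇔-Σb0 : Σb0 P → Hs ⊢ ¬¬' P ⇔ P
¬¬⇔-Σb0 sP =
  ⇔-trans (⇔-¬¬ (⇔-sym ∃-vacuous)) (⇔-trans (¬¬⇔-∃Σb1 (base (Σb0-ren there sP))) ∃-vacuous)

ᴺ⇔-∃ : Σb1 P → (∀ {Hs} → Hs ⊢ P ᴺ ⇔ P) → Hs ⊢ ∃' P ᴺ ⇔ ∃' P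
ᴺ⇔-∃ sP e = ⇔-trans (⇔-¬¬ (⇔-∃ e)) (¬¬⇔-∃Σb1 sP)

-- The renaming ρ makes the induction hypothesis available for the weakened body of ∃⊆*.
ᴺ⇔-Σb0-renF : Σb0 P → (ρ : Ren Γ Δ) → Hs ⊢ renF ρ P ᴺ ⇔ renF ρ P
ᴺ⇔-Σb0-renF (eq _ _)  ρ = ¬¬⇔-Σb0 (eq _ _)
ᴺ⇔-Σb0-renF (sb _ _)  ρ = ¬¬⇔-Σb0 (sb _ _)
ᴺ⇔-Σb0-renF (flip _)  ρ = ¬¬⇔-Σb0 (flip _)
ᴺ⇔-Σb0-renF (and a b) ρ = ⇔-∧ (ᴺ⇔-Σb0-renF a ρ) (ᴺ⇔-Σb0-renF b ρ)
ᴺ⇔-Σb0-renF (or a b)  ρ =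
  ⇔-trans (⇔-¬¬ (⇔-∨ (ᴺ⇔-Σb0-renF a ρ) (ᴺ⇔-Σb0-renF b ρ))) (¬¬⇔-Σb0 (Σb0-ren ρ (or a b)))
ᴺ⇔-Σb0-renF (imp a b) ρ = ⇔-⊃ (ᴺ⇔-Σb0-renF a ρ) (ᴺ⇔-Σb0-renF b ρ)
ᴺ⇔-Σb0-renF (bex t {F} a) ρ =
  ⇔-trans (⇔-¬¬ (⇔-∃ (⇔-¬¬ (⇔-∃ (⇔-∧ (¬¬⇔-Σb0 (sb _ _)) (⇔-∧ (¬¬⇔-Σb0 (sb _ _)) body))))))
          (⇔-trans ¬¬∃¬¬⇔¬¬∃ (¬¬⇔-Σb0 (Σb0-ren ρ (bex t a))))
  where
  body : Hs ⊢ renF (ext (ext ρ)) (wkF F) ᴺ ⇔ renF (ext (ext ρ)) (wkF F)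
  body = subst (λ G → _ ⊢ G ᴺ ⇔ G) (sym (renF-∘ (ext (ext ρ)) there (λ _ → refl) F))
               (ᴺ⇔-Σb0-renF a (λ x → ext (ext ρ) (there x)))
ᴺ⇔-Σb0-renF (ball t a) ρ =
  ⇔-∀ (⇔-⊃ (ᴺ⇔-∃ (base (and (sb _ _) (sb _ _))) (⇔-∧ (¬¬⇔-Σb0 (sb _ _)) (¬¬⇔-Σb0 (sb _ _))))
           (ᴺ⇔-Σb0-renF a (ext ρ)))

ᴺ⇔-Σb0 : Σb0 P → Hs ⊢ P ᴺ ⇔ P
ᴺ⇔-Σb0 {P = P} sP = subst (λ Q → _ ⊢ Q ᴺ ⇔ Q) (renF-id (λ _ → refl) P) (ᴺ⇔-Σb0-renF sP (λ x → x))

prenex-∧ : Σb0 P → Σb1 F → Σ (Fm _) λ G → Σb1 G × (∀ {Hs} → Hs ⊢ P ∧ F ⇔ G)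
prenex-∧ {P = P} {F = F} sP (base sF) = P ∧ F , base (and sP sF) , ⇔-refl
prenex-∧ sP (bex⪯ t sF) with prenex-∧ (Σb0-ren there sP) sF
... | G , sG , e = ∃⪯ t G , bex⪯ t sG , ⇔-trans ∧-∃ (⇔-∃ (⇔-trans ∧-left-comm (⇔-∧ ⇔-refl e)))

-- Markov's principle needs a Σb1 body, so the bound 1^x ⊆ 1^t is first absorbed into F.
¬¬⇔-Σb1 : Σb1 F → Hs ⊢ ¬¬' F ⇔ F
¬¬⇔-Σb1 (base sF) = ¬¬⇔-Σb0 sF
¬¬⇔-Σb1 (bex⪯ t sF) with prenex-∧ (sb (1^ (var here)) (1^ (wk t))) sF
... | G , sG , e = ⇔-trans (⇔-¬¬ (⇔-∃ e)) (⇔-trans (¬¬⇔-∃Σb1 sG) (⇔-sym (⇔-∃ e)))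

ᴺ⇔-Σb1 : Σb1 F → Hs ⊢ F ᴺ ⇔ F
ᴺ⇔-Σb1 (base sF)     = ᴺ⇔-Σb0 sF
ᴺ⇔-Σb1 (bex⪯ t sF) =
  ⇔-trans (⇔-¬¬ (⇔-∃ (⇔-∧ (¬¬⇔-Σb0 (sb _ _)) (ᴺ⇔-Σb1 sF)))) (¬¬⇔-Σb1 (bex⪯ t sF))

-- Substitution instances of the NP-induction formula ∃⪯ t (u ≐ v) keep this shape
-- definitionally, whereas their Σb1-ness would need a substitution lemma.
ᴺ⇔-∃⊆∧≐ : {x y u v : Tm (s ∷ Γ) s} → Hs ⊢ ∃' (x ⊆ y ∧ u ≐ v) ᴺ ⇔ ∃' (x ⊆ y ∧ u ≐ v)
ᴺ⇔-∃⊆∧≐ = ᴺ⇔-∃ (base (and (sb _ _) (eq _ _))) (⇔-∧ (¬¬⇔-Σb0 (sb _ _)) (¬¬⇔-Σb0 (eq _ _)))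

ᴺ-axiom : Ax P → Hs ⊢ P ᴺ
ᴺ-axiom a@(ε⌢ _)               = ¬¬-intro (ax a)
ᴺ-axiom a@(⌢ε _)               = ¬¬-intro (ax a)
ᴺ-axiom a@(⌢assoc _ _ _)       = ¬¬-intro (ax a)
ᴺ-axiom a@tailε                = ¬¬-intro (ax a)
ᴺ-axiom a@(tailb _ _)          = ¬¬-intro (ax a)
ᴺ-axiom a@(truncε₂ _)          = ¬¬-intro (ax a)
ᴺ-axiom a@(truncε₁ _)          = ¬¬-intro (ax a)
ᴺ-axiom a@(truncb _ _ _ _)     = ¬¬-intro (ax a)
ᴺ-axiom a@(condε _ _ _)        = ¬¬-intro (ax a)
ᴺ-axiom a@(cond0 _ _ _ _)      = ¬¬-intro (ax a)
ᴺ-axiom a@(cond1 _ _ _ _)      = ¬¬-intro (ax a)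
ᴺ-axiom a@(flipc _)            = ¬¬-intro (ax a)
ᴺ-axiom a@(recε _ _ _ _)       = ¬¬-intro (ax a)
ᴺ-axiom a@(recb _ _ _ _ _ _)   = ¬¬-intro (ax a)
ᴺ-axiom a@(βη _)               = ¬¬-intro (ax a)
ᴺ-axiom a@(concε _)            = ¬¬-intro (ax a)
ᴺ-axiom a@(concb _ _ _)        = ¬¬-intro (ax a)
ᴺ-axiom a@eqεε                 = ¬¬-intro (ax a)
ᴺ-axiom a@(eqεb _ _)           = ¬¬-intro (ax a)
ᴺ-axiom a@(eqbε _ _)           = ¬¬-intro (ax a)
ᴺ-axiom a@(eq01 _ _)           = ¬¬-intro (ax a)
ᴺ-axiom a@(eq10 _ _)           = ¬¬-intro (ax a)
ᴺ-axiom a@(eqbb _ _ _)         = ¬¬-intro (ax a)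
ᴺ-axiom a@(timesε _)           = ¬¬-intro (ax a)
ᴺ-axiom a@(timesb _ _ _)       = ¬¬-intro (ax a)
ᴺ-axiom a@(subε _)             = ¬¬-intro (ax a)
ᴺ-axiom a@(subb _ _ _)         = ¬¬-intro (ax a)
ᴺ-axiom a@(subAx _ _)          =
  ∧E₂ (ᴺ⇔-Σb0 (and (imp (sb _ _) (eq _ _)) (imp (eq _ _) (sb _ _)))) · ax a
ᴺ-axiom a@(cases _)            = ∧E₂ (ᴺ⇔-Σb0 (or (eq _ _) (or (eq _ _) (eq _ _)))) · ax a
ᴺ-axiom a@(triv _)             = ∧E₂ (ᴺ⇔-Σb0 (imp (eq _ _) (eq _ _))) · ax a
ᴺ-axiom a@(condAx _ _ _ _ _)   =
  ∧E₂ (ᴺ⇔-Σb0 (and (imp (eq _ _) branches) (imp branches (eq _ _)))) · ax a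
  where
  branches : Σb0 _
  branches = or (and (eq _ _) (eq _ _)) (or (and (eq _ _) (eq _ _)) (and (eq _ _) (eq _ _)))
ᴺ-axiom a@(flipAx _)           =
  ∧E₂ (ᴺ⇔-Σb0 (and (imp (flip _) (eq _ _)) (imp (eq _ _) (flip _)))) · ax a
ᴺ-axiom a@(npInd _ _ _ _)      =
  ∧E₂ (⇔-⊃ (⇔-∧ ᴺ⇔-∃⊆∧≐ (⇔-∧ (⇔-∀ (⇔-⊃ ᴺ⇔-∃⊆∧≐ ᴺ⇔-∃⊆∧≐)) (⇔-∀ (⇔-⊃ ᴺ⇔-∃⊆∧≐ ᴺ⇔-∃⊆∧≐))))
           (⇔-∀ ᴺ⇔-∃⊆∧≐)) · ax a

translate : Der EM Γ Hs P → map _ᴺ Hs ⊢ P ᴺ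
translate (hyp m)                 = hyp (∈-map⁺ _ᴺ m)
translate (ax a)                  = ᴺ-axiom a
translate (extra (em _))          = ¬¬-map (∨-map ⊃-refl (⊃-map ⊃-refl ¬¬-unit)) · ¬¬-em
translate (refl≐ t)               = ¬¬-intro (refl≐ t)
translate {Hs = Hs} (leib P {t} {u} d e) =
  ᴺ-stable (P [ u ]F)
    · (¬¬-map (⊃I (subst (_ ⊢_) (sym (ᴺ-[]F P u)) (leib (P ᴺ) hyp₀ (weaken₁ Pᴺ[t])))) · translate d)
  where
  Pᴺ[t] : map _ᴺ Hs ⊢ (P ᴺ) [ t ]F
  Pᴺ[t] = subst (_ ⊢_) (ᴺ-[]F P t) (translate e)
translate (∧I d e)                = ∧I (translate d) (translate e)
translate (∧E₁ d)                 = ∧E₁ (translate d)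
translate (∧E₂ d)                 = ∧E₂ (translate d)
translate (∨I₁ d)                 = ¬¬-intro (∨I₁ (translate d))
translate (∨I₂ d)                 = ¬¬-intro (∨I₂ (translate d))
translate (∨E {C = C} d e e')     =
  ᴺ-stable C · (¬¬-map (∨-case (translate e) (translate e')) · translate d)
translate (⊃I d)                  = ⊃I (translate d)
translate (⊃E d e)                = translate d · translate e
translate {Hs = Hs} (∀I d)        = ∀I (subst (_⊢ _) (map-ᴺ-wkF Hs) (translate d))
translate (∀E {A = P} d t)        = subst (_ ⊢_) (sym (ᴺ-[]F P t)) (∀E (translate d) t)
translate (∃I {A = P} t d)        = ¬¬-intro (∃I t (subst (_ ⊢_) (ᴺ-[]F P t) (translate d)))
translate {Hs = Hs} (∃E {A = P} {C = C} d e) =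
  ᴺ-stable C · (¬¬-map (∃-case Cᴺ) · translate d)
  where
  Cᴺ : P ᴺ ∷ map wkF (map _ᴺ Hs) ⊢ wkF (C ᴺ)
  Cᴺ = subst₂ (λ Ks Q → _ ∷ Ks ⊢ Q) (map-ᴺ-wkF Hs) (ᴺ-renF there C) (translate e)

mainTheorem13 : ∀ {Γ : Ctx} (F : Fm Γ) → Σb1 F → ⊢[ EM ] F → ⊢[ Markov ] F
mainTheorem13 F sF d = ∧E₁ (ᴺ⇔-Σb1 sF) · translate d
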